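{- Let $m$ be a positive integer and $k,l,n\in\mathbb{Z}$. Then $$\left\lfloor\frac{kn+ln}{m}\right\rfloor-\left\lfloor\frac{kn}{m}\right\rfloor-\left\lfloor\frac{ln+1}{m}\right\rfloor+\left\lfloor\frac{k}{m}\right\rfloor-\left\lfloor\frac{k-1}{m}\right\rfloor\geqslant 0.$$ -}

module Defs where

module Submission where

-- Write ⌊a⌋ for the floor quotient  a /ℕ m  (m > 0).  Two elementary facts
-- about ⌊_⌋ drive the proof:
--   (1) superadditivity:  ⌊x⌋ + ⌊y⌋ ≤ ⌊x + y⌋;
--   (2) unit steps:       ⌊x + 1⌋ ≤ ⌊x⌋ + 1, and ⌊x - 1⌋ ≤ ⌊x⌋ with
--                         equality exactly when m ∤ x.
-- With X = kn and Y = ln the expression is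
--   (⌊X + Y⌋ - ⌊X⌋ - ⌊Y + 1⌋) + (⌊k⌋ - ⌊k - 1⌋).
-- If m ∣ k the second bracket is 1 and the first is ≥ -1 by (1) and (2).
-- Otherwise the identity k = k(ln + 1) - l(kn) shows m ∤ kn or m ∤ ln + 1;
-- in either case the first bracket is ≥ 0 (shift the unit from X to Y + 1,
-- resp. note ⌊Y + 1⌋ = ⌊Y⌋, and apply (1)), and the second is ≥ 0.
-- The file first characterises ⌊_⌋ by its defining inequalities, derives
-- (1) and (2), combines them into a bound for arbitrary X, Y, k whose only
-- hypothesis is the divisibility implication, and finally supplies that
-- implication for X = kn, Y = ln.

open import Defs
open import Data.Nat using (ℕ; NonZero)
open import Data.Integer using (ℤ; +_; _+_; _-_; _*_; _≤_; _/ℕ_; 0ℤ; 1ℤ)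
open import Data.Integer using (_<_; -1ℤ; suc; pred; Positive; positive; +<+)
import Data.Nat as ℕ
open import Data.Integer.Properties
open import Data.Integer.DivMod using ([n/ℕd]*d≤n; n<s[n/ℕd]*d)
open import Data.Integer.Divisibility.Signed
  using (_∣_; divides; _∣?_; ∣m∣n⇒∣m-n; ∣n⇒∣m*n)
open import Data.Integer.Tactic.RingSolver using (solve-∀)
open import Data.Sum using (_⊎_; inj₁; inj₂)
open import Relation.Binary.PropositionalEquality using (_≡_; _≢_; sym; subst; cong)
open import Relation.Nullary using (¬_; yes; no)

divides-factor : ∀ {d} k l n → d ∣ k * n → d ∣ l * n + 1ℤ → d ∣ k
divides-factor {d} k l n d∣kn d∣ln+1 =
  subst (d ∣_) (combination k l n) (∣m∣n⇒∣m-n (∣n⇒∣m*n k d∣ln+1) (∣n⇒∣m*n l d∣kn))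
  where
  combination : ∀ k l n → k * (l * n + 1ℤ) - l * (k * n) ≡ k
  combination = solve-∀

nonneg-from-sums : ∀ a b c d e → b + c + e ≤ a + d → 0ℤ ≤ a - b - c + d - e
nonneg-from-sums a b c d e le =
  subst (0ℤ ≤_) (regroup a b c d e) (i≤j⇒0≤j-i le)
  where
  regroup : ∀ a b c d e → a + d - (b + c + e) ≡ a - b - c + d - e
  regroup = solve-∀

module FloorQuotient (m : ℕ) .{{_ : NonZero m}} where

  M : ℤ
  M = + m

  ⌊_⌋ : ℤ → ℤ
  ⌊ x ⌋ = x /ℕ m

  instance
    M-positive : Positive M
    M-positive = positive (+<+ (ℕ.>-nonZero⁻¹ m))

  quotient-lower : ∀ {q x} → q * M ≤ x → q ≤ ⌊ x ⌋
  quotient-lower {q} {x} qM≤x = ≮⇒≥ λ ⌊x⌋<q →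
    <⇒≱ (n<s[n/ℕd]*d x m) (≤-trans (*-monoʳ-≤-nonNeg M (i<j⇒suc[i]≤j ⌊x⌋<q)) qM≤x)

  quotient-upper : ∀ {q x} → x ≤ q * M → ⌊ x ⌋ ≤ q
  quotient-upper {q} {x} x≤qM = *-cancelʳ-≤-pos ⌊ x ⌋ q M (≤-trans ([n/ℕd]*d≤n x m) x≤qM)

  quotient-upper-strict : ∀ {q x} → x < q * M → ⌊ x ⌋ < q
  quotient-upper-strict {q} {x} x<qM = *-cancelʳ-<-nonNeg M (≤-<-trans ([n/ℕd]*d≤n x m) x<qM)

  quotient-mono : ∀ {x y} → x ≤ y → ⌊ x ⌋ ≤ ⌊ y ⌋
  quotient-mono {x} {y} x≤y = quotient-lower (≤-trans ([n/ℕd]*d≤n x m) x≤y)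

  quotient-superadditive : ∀ x y → ⌊ x ⌋ + ⌊ y ⌋ ≤ ⌊ x + y ⌋
  quotient-superadditive x y = quotient-lower (begin
    (⌊ x ⌋ + ⌊ y ⌋) * M    ≡⟨ *-distribʳ-+ M ⌊ x ⌋ ⌊ y ⌋ ⟩
    ⌊ x ⌋ * M + ⌊ y ⌋ * M  ≤⟨ +-mono-≤ ([n/ℕd]*d≤n x m) ([n/ℕd]*d≤n y m) ⟩
    x + y                  ∎)
    where open ≤-Reasoning

  quotient-suc : ∀ x → ⌊ x + 1ℤ ⌋ ≤ ⌊ x ⌋ + 1ℤ
  quotient-suc x = quotient-upper (begin
    x + 1ℤ            ≡⟨ +-comm x 1ℤ ⟩
    suc x             ≤⟨ i<j⇒suc[i]≤j (n<s[n/ℕd]*d x m) ⟩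
    suc ⌊ x ⌋ * M     ≡⟨ cong (_* M) (+-comm 1ℤ ⌊ x ⌋) ⟩
    (⌊ x ⌋ + 1ℤ) * M  ∎)
    where open ≤-Reasoning

  -- x - 1 < x, with the predecessor written as the target writes it.
  pred-< : ∀ x → x - 1ℤ < x
  pred-< x = i≤pred[j]⇒i<j (≤-reflexive (+-comm x -1ℤ))

  quotient-pred-divisible : ∀ {x} → M ∣ x → ⌊ x - 1ℤ ⌋ < ⌊ x ⌋
  quotient-pred-divisible {x} (divides q x≡qM) =
    <-≤-trans (quotient-upper-strict {q} (subst (x - 1ℤ <_) x≡qM (pred-< x)))
              (quotient-lower {q} (≤-reflexive (sym x≡qM)))

  quotient-pred-nondivisible : ∀ {x} → ¬ (M ∣ x) → ⌊ x ⌋ ≤ ⌊ x - 1ℤ ⌋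
  quotient-pred-nondivisible {x} m∤x = quotient-lower (begin
    ⌊ x ⌋ * M  ≤⟨ i<j⇒i≤pred[j] (≤∧≢⇒< ([n/ℕd]*d≤n x m) ⌊x⌋m≢x) ⟩
    pred x     ≡⟨ +-comm -1ℤ x ⟩
    x - 1ℤ     ∎)
    where
    open ≤-Reasoning
    ⌊x⌋m≢x : ⌊ x ⌋ * M ≢ x
    ⌊x⌋m≢x eq = m∤x (divides ⌊ x ⌋ (sym eq))

  shifted-superadditive : ∀ X Y → ⌊ X ⌋ + ⌊ Y + 1ℤ ⌋ ≤ ⌊ X + Y ⌋ + 1ℤ
  shifted-superadditive X Y = begin
    ⌊ X ⌋ + ⌊ Y + 1ℤ ⌋    ≤⟨ +-monoʳ-≤ ⌊ X ⌋ (quotient-suc Y) ⟩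
    ⌊ X ⌋ + (⌊ Y ⌋ + 1ℤ)  ≡⟨ sym (+-assoc ⌊ X ⌋ ⌊ Y ⌋ 1ℤ) ⟩
    ⌊ X ⌋ + ⌊ Y ⌋ + 1ℤ    ≤⟨ +-monoˡ-≤ 1ℤ (quotient-superadditive X Y) ⟩
    ⌊ X + Y ⌋ + 1ℤ        ∎
    where open ≤-Reasoning

  shifted-superadditive-strict : ∀ X Y → ¬ (M ∣ X) ⊎ ¬ (M ∣ Y + 1ℤ) →
                                 ⌊ X ⌋ + ⌊ Y + 1ℤ ⌋ ≤ ⌊ X + Y ⌋
  shifted-superadditive-strict X Y (inj₁ m∤X) = begin
    ⌊ X ⌋ + ⌊ Y + 1ℤ ⌋       ≤⟨ +-monoˡ-≤ ⌊ Y + 1ℤ ⌋ (quotient-pred-nondivisible m∤X) ⟩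
    ⌊ X - 1ℤ ⌋ + ⌊ Y + 1ℤ ⌋  ≤⟨ quotient-superadditive (X - 1ℤ) (Y + 1ℤ) ⟩
    ⌊ X - 1ℤ + (Y + 1ℤ) ⌋    ≡⟨ cong ⌊_⌋ (unit-moves X Y) ⟩
    ⌊ X + Y ⌋                ∎
    where
    open ≤-Reasoning
    unit-moves : ∀ X Y → X - 1ℤ + (Y + 1ℤ) ≡ X + Y
    unit-moves = solve-∀
  shifted-superadditive-strict X Y (inj₂ m∤Y+1) = begin
    ⌊ X ⌋ + ⌊ Y + 1ℤ ⌋       ≤⟨ +-monoʳ-≤ ⌊ X ⌋ (quotient-pred-nondivisible m∤Y+1) ⟩
    ⌊ X ⌋ + ⌊ Y + 1ℤ - 1ℤ ⌋  ≡⟨ cong (λ z → ⌊ X ⌋ + ⌊ z ⌋) (unit-cancels Y) ⟩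
    ⌊ X ⌋ + ⌊ Y ⌋            ≤⟨ quotient-superadditive X Y ⟩
    ⌊ X + Y ⌋                ∎
    where
    open ≤-Reasoning
    unit-cancels : ∀ Y → Y + 1ℤ - 1ℤ ≡ Y
    unit-cancels = solve-∀

  floor-combination : ∀ X Y k → (M ∣ X → M ∣ Y + 1ℤ → M ∣ k) →
    0ℤ ≤ ⌊ X + Y ⌋ - ⌊ X ⌋ - ⌊ Y + 1ℤ ⌋ + ⌊ k ⌋ - ⌊ k - 1ℤ ⌋
  floor-combination X Y k forces with M ∣? k
  ... | yes m∣k = nonneg-from-sums ⌊ X + Y ⌋ ⌊ X ⌋ ⌊ Y + 1ℤ ⌋ ⌊ k ⌋ ⌊ k - 1ℤ ⌋ (begin
    ⌊ X ⌋ + ⌊ Y + 1ℤ ⌋ + ⌊ k - 1ℤ ⌋  ≤⟨ +-monoˡ-≤ ⌊ k - 1ℤ ⌋ (shifted-superadditive X Y) ⟩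
    ⌊ X + Y ⌋ + 1ℤ + ⌊ k - 1ℤ ⌋      ≡⟨ +-assoc ⌊ X + Y ⌋ 1ℤ ⌊ k - 1ℤ ⌋ ⟩
    ⌊ X + Y ⌋ + suc ⌊ k - 1ℤ ⌋       ≤⟨ +-monoʳ-≤ ⌊ X + Y ⌋ (i<j⇒suc[i]≤j (quotient-pred-divisible m∣k)) ⟩
    ⌊ X + Y ⌋ + ⌊ k ⌋                ∎)
    where open ≤-Reasoning
  ... | no m∤k = nonneg-from-sums ⌊ X + Y ⌋ ⌊ X ⌋ ⌊ Y + 1ℤ ⌋ ⌊ k ⌋ ⌊ k - 1ℤ ⌋
    (+-mono-≤ (shifted-superadditive-strict X Y m∤X⊎m∤Y+1) (quotient-mono (<⇒≤ (pred-< k))))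
    where
    m∤X⊎m∤Y+1 : ¬ (M ∣ X) ⊎ ¬ (M ∣ Y + 1ℤ)
    m∤X⊎m∤Y+1 with M ∣? X
    ... | no m∤X = inj₁ m∤X
    ... | yes m∣X = inj₂ λ m∣Y+1 → m∤k (forces m∣X m∣Y+1)

open FloorQuotient using (floor-combination)

lemma3p3 : (m : ℕ) → .{{_ : NonZero m}} → (k l n : ℤ) →
    0ℤ ≤ ((k * n + l * n) /ℕ m) - ((k * n) /ℕ m) - ((l * n + 1ℤ) /ℕ m) + (k /ℕ m) - ((k - 1ℤ) /ℕ m)
lemma3p3 m k l n = floor-combination m (k * n) (l * n) k (divides-factor k l n)
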